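{- Let $\sigma$ be a ground local solution of $\Gamma$. Then the valuation $\tau_\sigma$ satisfies all clauses of $\mathsf{Cl}(\Gamma)$.
   Context: $\mathcal{EL}$ concept terms are built from concept names and role names using $C\sqcap D$, $\exists r.C$ and $\top$; $C\sqsubseteq D$ means $C^{\mathcal I}\subseteq D^{\mathcal I}$ in every interpretation. Concept names are split into variables $N_v$ and constants $N_c$. $\Gamma$ is a flat disunification problem: subsumptions $C_1\sqcap\dots\sqcap C_n\sqsubseteq^? D$ of flat atoms (concept names or $\exists r.A$, $A$ a concept name) and dissubsumptions, all of the form $X\not\sqsubseteq^? Y$ with variables $X,Y$; $N_v,N_c,N_R$ are exactly the variables, constants and roles occurring in $\Gamma$. $\mathsf{At}$ = atoms occurring as subterms of $\Gamma$, $\mathsf{At_{nv}}=\mathsf{At}\setminus N_v$. A local solution is a solution of the form $\sigma_S$ where $S$ assigns each variable $X$ a set $S_X\subseteq\mathsf{At_{nv}}$, the relation "$Y$ occurs in an atom of $S_X$" has an irreflexive transitive closure, and $\sigma_S(X):=\sigma_S(D_1)\sqcap\dots\sqcap\sigma_S(D_k)$ for $S_X=\{D_1,\dots,D_k\}$ ($\top$ if empty); in particular every top-level atom of $\sigma(X)$ has the form $\sigma(F)$ with $F\in\mathsf{At_{nv}}$. $\mathsf{Cl}(\Gamma)$ is the clause set over propositional variables $[C\sqsubseteq D]$ ($C,D\in\mathsf{At}$), $[X>Y]$ ($X,Y\in N_v$), $p_{C,X,D}$ ($C\in\mathsf{At}$, $X\in N_v$, $D\in\mathsf{At_{nv}}$):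 (Ia) for each $C_1\sqcap\dots\sqcap C_n\sqsubseteq^? D$ in $\Gamma$ with $D\in\mathsf{At_{nv}}$: $[C_1\sqsubseteq D]\lor\dots\lor[C_n\sqsubseteq D]$; (Ib) for each $C_1\sqcap\dots\sqcap C_n\sqsubseteq^? X$ in $\Gamma$, $X\in N_v$, and $E\in\mathsf{At_{nv}}$: $[X\sqsubseteq E]\to[C_1\sqsubseteq E]\lor\dots\lor[C_n\sqsubseteq E]$; (Ic) for each $X\not\sqsubseteq^? Y$ in $\Gamma$: $\lnot[X\sqsubseteq Y]$; (IIa) $[A\sqsubseteq A]$ for $A\in N_c$; (IIb) $\lnot[A\sqsubseteq B]$ for distinct $A,B\in N_c$; (IIc) $\lnot[\exists r.A\sqsubseteq\exists s.B]$ for $\exists r.A,\exists s.B\in\mathsf{At_{nv}}$, $r\ne s$; (IId) $\lnot[A\sqsubseteq\exists r.B]$ and $\lnot[\exists r.B\sqsubseteq A]$ for $A\in N_c$, $\exists r.B\in\mathsf{At_{nv}}$; (IIe) $[\exists r.A\sqsubseteq\exists r.B]\to[A\sqsubseteq B]$ and $[A\sqsubseteq B]\to[\exists r.A\sqsubseteq\exists r.B]$; (III) $[C_1\sqsubseteq C_2]\land[C_2\sqsubseteq C_3]\to[C_1\sqsubseteq C_3]$ for $C_1,C_2,C_3\in\mathsf{At}$; (IV) for $C\in\mathsf{At}$, $X\in N_v$: $[C\sqsubseteq X]\lor\bigvee_{D\in\mathsf{At_{nv}}}p_{C,X,D}$, and for each $D\in\mathsf{At_{nv}}$: $p_{C,X,D}\to[X\sqsubseteq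 D]$ and $\lnot(p_{C,X,D}\land[C\sqsubseteq D])$; (Va) $\lnot[X>X]$; (Vb) $[X>Y]\land[Y>Z]\to[X>Z]$; (Vc) $[X\sqsubseteq\exists r.Y]\to[X>Y]$ for $X,Y\in N_v$ with $\exists r.Y\in\mathsf{At}$. Define $X>_\sigma Y$ iff $\sigma(X)\sqsubseteq\exists r_1.\cdots\exists r_n.\sigma(Y)$ for some roles $r_1,\dots,r_n$, $n\ge1$ (a strict partial order). The valuation $\tau_\sigma$ sets $[C\sqsubseteq D]$ true iff $\sigma(C)\sqsubseteq\sigma(D)$; $p_{C,X,E}$ true iff $\sigma(X)\sqsubseteq\sigma(E)$ and $\sigma(C)\not\sqsubseteq\sigma(E)$; $[X>Y]$ true iff $X>_\sigma Y$. -}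

module Defs where

open import Data.Nat using (ℕ)
open import Data.Bool using (Bool; true; false; not)
open import Data.List using (List; []; _∷_; map; concatMap; filterᵇ; _++_)
open import Data.List.Membership.Propositional using (_∈_)
open import Data.List.Relation.Unary.Any using (Any)
open import Data.Product using (Σ; _×_; _,_)
open import Data.Empty using (⊥)
open import Data.Unit using (⊤)
open import Relation.Nullary using (¬_)
open import Relation.Binary.PropositionalEquality using (_≡_; _≢_)
open import Relation.Binary.Construct.Closure.Transitive using (TransClosure)

data Name : Set where
  var : ℕ → Name
  con : ℕ → Name

Role : Set
Role = ℕ

data Concept : Set where
  ⊤c   : Concept
  nm   : Name → Concept
  _⊓_  : Concept → Concept → Concept
  ∃[_]_ : Role → Concept → Concept

record Interp : Set₁ where
  field
    Δ  : Set
    cI : Name → Δ → Set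
    rI : Role → Δ → Δ → Set

⟦_⟧ : Concept → (I : Interp) → Interp.Δ I → Set
⟦ ⊤c ⟧ I d = ⊤
⟦ nm A ⟧ I d = Interp.cI I A d
⟦ C ⊓ D ⟧ I d = ⟦ C ⟧ I d × ⟦ D ⟧ I d
⟦ ∃[ r ] C ⟧ I d = Σ (Interp.Δ I) λ e → Interp.rI I r d e × ⟦ C ⟧ I e

_⊑_ : Concept → Concept → Set₁
C ⊑ D = (I : Interp) → (d : Interp.Δ I) → ⟦ C ⟧ I d → ⟦ D ⟧ I d

conj : List Concept → Concept
conj [] = ⊤c
conj (C ∷ []) = C
conj (C ∷ D ∷ Cs) = C ⊓ conj (D ∷ Cs)

exs : List Role → Concept → Concept
exs [] C = C
exs (r ∷ rs) C = ∃[ r ] exs rs C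

Ground : Concept → Set
Ground ⊤c = ⊤
Ground (nm (var _)) = ⊥
Ground (nm (con _)) = ⊤
Ground (C ⊓ D) = Ground C × Ground D
Ground (∃[ r ] C) = Ground C

data Atom : Set where
  at : Name → Atom
  ex : Role → Name → Atom

isVarAtom : Atom → Bool
isVarAtom (at (var _)) = true
isVarAtom (at (con _)) = false
isVarAtom (ex _ _) = false

atomSubs : Atom → List Atom
atomSubs (at A) = at A ∷ []
atomSubs (ex r A) = ex r A ∷ at A ∷ []

record Subs : Set where
  constructor _⊑?_
  field
    lhs : List Atom
    rhs : Atom
open Subs public

-- flat disunification problem: subsumptions and dissubsumptions X ⋢? Y
-- (dissubsumption X ⋢? Y stored as the pair of variable indices (X , Y))
record Problem : Set where
  field
    subs : List Subs
    dis  : List (ℕ × ℕ)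
open Problem public

At : Problem → List Atom
At Γ = concatMap (λ s → concatMap atomSubs (rhs s ∷ lhs s)) (subs Γ)
    ++ concatMap (λ { (X , Y) → at (var X) ∷ at (var Y) ∷ [] }) (dis Γ)

Atnv : Problem → List Atom
Atnv Γ = filterᵇ (λ a → not (isVarAtom a)) (At Γ)

InNv : Problem → ℕ → Set
InNv Γ X = at (var X) ∈ At Γ

InNc : Problem → ℕ → Set
InNc Γ A = at (con A) ∈ At Γ

Subst : Set
Subst = ℕ → Concept

applyN : Subst → Name → Concept
applyN σ (var X) = σ X
applyN σ (con A) = nm (con A)

applyA : Subst → Atom → Concept
applyA σ (at A) = applyN σ A
applyA σ (ex r A) = ∃[ r ] applyN σ A

IsSolution : Problem → Subst → Set₁
IsSolution Γ σ =
  ((s : Subs) → s ∈ subs Γ → conj (map (applyA σ) (lhs s)) ⊑ applyA σ (rhs s))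
  × ((X Y : ℕ) → (X , Y) ∈ dis Γ → ¬ (σ X ⊑ σ Y))

IsGround : Problem → Subst → Set
IsGround Γ σ = (X : ℕ) → InNv Γ X → Ground (σ X)

OccursIn : Problem → (ℕ → List Atom) → ℕ → ℕ → Set
OccursIn Γ S X Y = InNv Γ X × Any (λ D → Σ Role λ r → D ≡ ex r (var Y)) (S X)

IsLocal : Problem → Subst → Set
IsLocal Γ σ = Σ (ℕ → List Atom) λ S →
    ((X : ℕ) → InNv Γ X → (D : Atom) → D ∈ S X → D ∈ Atnv Γ)
  × ((X : ℕ) → ¬ TransClosure (OccursIn Γ S) X X)
  × ((X : ℕ) → InNv Γ X → σ X ≡ conj (map (applyA σ) (S X)))

GroundLocalSolution : Problem → Subst → Set₁
GroundLocalSolution Γ σ = IsSolution Γ σ × IsGround Γ σ × IsLocal Γ σ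

data PVar : Set where
  [_⊑_]    : Atom → Atom → PVar
  [_>_]    : ℕ → ℕ → PVar
  p[_,_,_] : Atom → ℕ → Atom → PVar

data Lit : Set where
  +_ : PVar → Lit
  -_ : PVar → Lit

Clause : Set
Clause = List Lit

v : ℕ → Atom
v X = at (var X)

c : ℕ → Atom
c A = at (con A)

-- Cl(Γ), as a predicate on clauses (implications written as disjunctions)
data Cl (Γ : Problem) : Clause → Set where
  Ia  : ∀ s → s ∈ subs Γ → isVarAtom (rhs s) ≡ false →
        Cl Γ (map (λ C → + [ C ⊑ rhs s ]) (lhs s))
  Ib  : ∀ s X E → s ∈ subs Γ → rhs s ≡ v X → E ∈ Atnv Γ →
        Cl Γ (- [ v X ⊑ E ] ∷ map (λ C → + [ C ⊑ E ]) (lhs s))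
  Ic  : ∀ X Y → (X , Y) ∈ dis Γ → Cl Γ (- [ v X ⊑ v Y ] ∷ [])
  IIa : ∀ A → InNc Γ A → Cl Γ (+ [ c A ⊑ c A ] ∷ [])
  IIb : ∀ A B → InNc Γ A → InNc Γ B → A ≢ B → Cl Γ (- [ c A ⊑ c B ] ∷ [])
  IIc : ∀ r A s B → ex r A ∈ Atnv Γ → ex s B ∈ Atnv Γ → r ≢ s →
        Cl Γ (- [ ex r A ⊑ ex s B ] ∷ [])
  IId₁ : ∀ A r B → InNc Γ A → ex r B ∈ Atnv Γ → Cl Γ (- [ c A ⊑ ex r B ] ∷ [])
  IId₂ : ∀ A r B → InNc Γ A → ex r B ∈ Atnv Γ → Cl Γ (- [ ex r B ⊑ c A ] ∷ [])
  IIe₁ : ∀ r A B → ex r A ∈ Atnv Γ → ex r B ∈ Atnv Γ →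
         Cl Γ (- [ ex r A ⊑ ex r B ] ∷ + [ at A ⊑ at B ] ∷ [])
  IIe₂ : ∀ r A B → ex r A ∈ Atnv Γ → ex r B ∈ Atnv Γ →
         Cl Γ (- [ at A ⊑ at B ] ∷ + [ ex r A ⊑ ex r B ] ∷ [])
  III : ∀ C₁ C₂ C₃ → C₁ ∈ At Γ → C₂ ∈ At Γ → C₃ ∈ At Γ →
        Cl Γ (- [ C₁ ⊑ C₂ ] ∷ - [ C₂ ⊑ C₃ ] ∷ + [ C₁ ⊑ C₃ ] ∷ [])
  IV₁ : ∀ C X → C ∈ At Γ → InNv Γ X →
        Cl Γ (+ [ C ⊑ v X ] ∷ map (λ D → + p[ C , X , D ]) (Atnv Γ))
  IV₂ : ∀ C X D → C ∈ At Γ → InNv Γ X → D ∈ Atnv Γ →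
        Cl Γ (- p[ C , X , D ] ∷ + [ v X ⊑ D ] ∷ [])
  IV₃ : ∀ C X D → C ∈ At Γ → InNv Γ X → D ∈ Atnv Γ →
        Cl Γ (- p[ C , X , D ] ∷ - [ C ⊑ D ] ∷ [])
  Va  : ∀ X → InNv Γ X → Cl Γ (- [ X > X ] ∷ [])
  Vb  : ∀ X Y Z → InNv Γ X → InNv Γ Y → InNv Γ Z →
        Cl Γ (- [ X > Y ] ∷ - [ Y > Z ] ∷ + [ X > Z ] ∷ [])
  Vc  : ∀ X r Y → InNv Γ X → InNv Γ Y → ex r (var Y) ∈ At Γ →
        Cl Γ (- [ v X ⊑ ex r (var Y) ] ∷ + [ X > Y ] ∷ [])

_>[_]_ : ℕ → Subst → ℕ → Set₁
X >[ σ ] Y = Σ Role λ r → Σ (List Role) λ rs → σ X ⊑ exs (r ∷ rs) (σ Y)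

τ : Subst → PVar → Set₁
τ σ [ C ⊑ D ] = applyA σ C ⊑ applyA σ D
τ σ [ X > Y ] = X >[ σ ] Y
τ σ p[ C , X , E ] = (σ X ⊑ applyA σ E) × ¬ (applyA σ C ⊑ applyA σ E)

SatLit : (PVar → Set₁) → Lit → Set₁
SatLit val (+ x) = val x
SatLit val (- x) = ¬ val x

SatClause : (PVar → Set₁) → Clause → Set₁
SatClause val cl = Any (SatLit val) cl

-- In the canonical model, whose elements are concepts and in which a concept
-- lies in A, resp. has e as r-successor, when A, resp. ∃r.e, is one of its
-- top-level conjuncts, every concept C belongs to its own extension; hence
-- C ⊑ D holds iff C belongs to the extension of D. This makes subsumption
-- decidable, which is what a constructive clause-by-clause check needs, and it
-- yields the structural facts behind clauses II–V: an atom subsumes a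
-- conjunction only if it subsumes a conjunct, ∃r.C ⊑ ∃s.D forces r = s and
-- C ⊑ D, and subsumption cannot increase role depth, so C ⊑ ∃r₁.⋯∃rₙ.C is
-- impossible for n ≥ 1. The clauses of type I follow from σ solving Γ, and IV
-- from σ(X) being the conjunction of the σ(D) with D ∈ S_X.

module Submission where

open import Defs
open import Data.Nat using (ℕ; suc; _≤_; _⊔_; z≤n; s≤s)
open import Data.Nat.Properties
  using (≤-refl; ≤-trans; n≤1+n; ⊔-lub; m≤n⇒m≤n⊔o; m≤n⇒m≤o⊔n; 1+n≰n)
  renaming (_≟_ to _≟ℕ_)
open import Data.Bool using (not; T; false)
open import Data.List using (List; []; _∷_; map; _++_)
open import Data.List.Membership.Propositional using (_∈_; find; lose)
open import Data.List.Membership.Propositional.Properties using (∈-filter⁻; ∈-map⁺)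
open import Data.List.Relation.Unary.Any using (Any; here; there)
import Data.List.Relation.Unary.Any as Any
open import Data.List.Relation.Unary.Any.Properties using (map⁺; map⁻)
open import Data.List.Relation.Unary.All using (All; []; _∷_; all?)
import Data.List.Relation.Unary.All.Properties as All
open import Data.Product using (∃; ∃₂; _×_; _,_; proj₁; proj₂)
open import Data.Sum using (_⊎_; inj₁; inj₂)
open import Data.Empty using (⊥)
open import Data.Unit using (tt)
open import Function using (_∘_; id)
open import Relation.Nullary using (¬_; Dec; yes; no)
open import Relation.Nullary.Decidable using (map′; _×-dec_; _⊎-dec_; ¬?; T?)
open import Relation.Binary.Definitions using (DecidableEquality)
open import Relation.Binary.PropositionalEquality using (_≡_; refl; sym; cong; subst)

⊑-refl : ∀ {C} → C ⊑ C
⊑-refl I d x = x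

⊑-trans : ∀ {C D E} → C ⊑ D → D ⊑ E → C ⊑ E
⊑-trans C⊑D D⊑E I d = D⊑E I d ∘ C⊑D I d

∃-mono : ∀ {r C D} → C ⊑ D → (∃[ r ] C) ⊑ (∃[ r ] D)
∃-mono C⊑D I d (e , de , Ce) = e , de , C⊑D I e Ce

exs-mono : ∀ rs {C D} → C ⊑ D → exs rs C ⊑ exs rs D
exs-mono []       C⊑D = C⊑D
exs-mono (r ∷ rs) {C} {D} C⊑D = ∃-mono {r} {exs rs C} {exs rs D} (exs-mono rs C⊑D)

exs-++ : ∀ rs qs C → exs rs (exs qs C) ≡ exs (rs ++ qs) C
exs-++ []       qs C = refl
exs-++ (r ∷ rs) qs C = cong (∃[ r ]_) (exs-++ rs qs C)

conj-⊑ : ∀ {C} L → C ∈ L → conj L ⊑ C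
conj-⊑ (C ∷ [])     (here refl) = ⊑-refl {C}
conj-⊑ (_ ∷ _ ∷ _)  (here refl) I d = proj₁
conj-⊑ (_ ∷ D ∷ L) (there C∈L) I d = conj-⊑ (D ∷ L) C∈L I d ∘ proj₂

⊑-conj : ∀ {C} L → All (C ⊑_) L → C ⊑ conj L
⊑-conj []          []                     I d x = tt
⊑-conj (_ ∷ [])    (C⊑D ∷ [])             = C⊑D
⊑-conj {C} (_ ∷ D ∷ L) (C⊑D ∷ C⊑L) I d x = C⊑D I d x , ⊑-conj {C} (D ∷ L) C⊑L I d x

TopConjunct : Concept → Concept → Set
TopConjunct D ⊤c         = ⊥
TopConjunct D (nm A)     = D ≡ nm A
TopConjunct D (C ⊓ C′)   = TopConjunct D C ⊎ TopConjunct D C′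
TopConjunct D (∃[ r ] C) = D ≡ ∃[ r ] C

canonical : Interp
canonical = record
  { Δ  = Concept
  ; cI = λ A P → TopConjunct (nm A) P
  ; rI = λ r P e → TopConjunct (∃[ r ] e) P
  }

canonical-⊇ : ∀ C P → (∀ {D} → TopConjunct D C → TopConjunct D P) → ⟦ C ⟧ canonical P
canonical-⊇ ⊤c         P C⊆P = tt
canonical-⊇ (nm A)     P C⊆P = C⊆P refl
canonical-⊇ (C ⊓ C′)   P C⊆P = canonical-⊇ C P (C⊆P ∘ inj₁) , canonical-⊇ C′ P (C⊆P ∘ inj₂)
canonical-⊇ (∃[ r ] C) P C⊆P = C , C⊆P refl , canonical-⊇ C C id

canonical-self : ∀ C → ⟦ C ⟧ canonical C
canonical-self C = canonical-⊇ C C id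

TopConjunct⇒⊑ : ∀ {D} P → TopConjunct D P → P ⊑ D
TopConjunct⇒⊑ (nm A)     refl         = ⊑-refl {nm A}
TopConjunct⇒⊑ (P ⊓ P′)   (inj₁ D∈P)  I d = TopConjunct⇒⊑ P D∈P I d ∘ proj₁
TopConjunct⇒⊑ (P ⊓ P′)   (inj₂ D∈P′) I d = TopConjunct⇒⊑ P′ D∈P′ I d ∘ proj₂
TopConjunct⇒⊑ (∃[ r ] P) refl         = ⊑-refl {∃[ r ] P}

canonical⇒⊑ : ∀ D P → ⟦ D ⟧ canonical P → P ⊑ D
canonical⇒⊑ ⊤c         P _                 I d x = tt
canonical⇒⊑ (nm A)     P A∈P               = TopConjunct⇒⊑ P A∈P
canonical⇒⊑ (D ⊓ D′)   P (DP , D′P)        I d x =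
  canonical⇒⊑ D P DP I d x , canonical⇒⊑ D′ P D′P I d x
canonical⇒⊑ (∃[ r ] D) P (e , ∃re∈P , De) =
  ⊑-trans {P} {∃[ r ] e} {∃[ r ] D}
          (TopConjunct⇒⊑ P ∃re∈P) (∃-mono {r} {e} {D} (canonical⇒⊑ D e De))

⊑⇒canonical : ∀ {P D} → P ⊑ D → ⟦ D ⟧ canonical P
⊑⇒canonical {P} P⊑D = P⊑D canonical P (canonical-self P)

_≟ᴺ_ : DecidableEquality Name
var x ≟ᴺ var y = map′ (cong var) (λ { refl → refl }) (x ≟ℕ y)
var x ≟ᴺ con y = no λ ()
con x ≟ᴺ var y = no λ ()
con x ≟ᴺ con y = map′ (cong con) (λ { refl → refl }) (x ≟ℕ y)

nm-TopConjunct? : ∀ A P → Dec (TopConjunct (nm A) P)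
nm-TopConjunct? A ⊤c         = no λ ()
nm-TopConjunct? A (nm B)     = map′ (cong nm) (λ { refl → refl }) (A ≟ᴺ B)
nm-TopConjunct? A (P ⊓ P′)   = nm-TopConjunct? A P ⊎-dec nm-TopConjunct? A P′
nm-TopConjunct? A (∃[ r ] P) = no λ ()

successor? : ∀ {Q : Concept → Set} r P → (∀ e → Dec (Q e)) →
             Dec (∃ λ e → TopConjunct (∃[ r ] e) P × Q e)
successor? r ⊤c Q? = no λ ()
successor? r (nm A) Q? = no λ { (_ , () , _) }
successor? r (P ⊓ P′) Q? =
  map′ (λ { (inj₁ (e , e∈P , Qe)) → e , inj₁ e∈P , Qe
          ; (inj₂ (e , e∈P′ , Qe)) → e , inj₂ e∈P′ , Qe })
       (λ { (e , inj₁ e∈P , Qe) → inj₁ (e , e∈P , Qe)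
          ; (e , inj₂ e∈P′ , Qe) → inj₂ (e , e∈P′ , Qe) })
       (successor? r P Q? ⊎-dec successor? r P′ Q?)
successor? r (∃[ s ] P) Q? with r ≟ℕ s | Q? P
... | yes refl | yes QP = yes (P , refl , QP)
... | yes refl | no ¬QP = no λ { (_ , refl , QP) → ¬QP QP }
... | no r≢s   | _      = no λ { (_ , refl , _) → r≢s refl }

canonical? : ∀ D P → Dec (⟦ D ⟧ canonical P)
canonical? ⊤c         P = yes tt
canonical? (nm A)     P = nm-TopConjunct? A P
canonical? (D ⊓ D′)   P = canonical? D P ×-dec canonical? D′ P
canonical? (∃[ r ] D) P = successor? r P (canonical? D)

⊑-dec : ∀ C D → Dec (C ⊑ D)
⊑-dec C D = map′ (canonical⇒⊑ D C) (⊑⇒canonical {C} {D}) (canonical? D C)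

data Atomic : Concept → Set where
  atomic-nm : ∀ A → Atomic (nm A)
  atomic-∃  : ∀ r C → Atomic (∃[ r ] C)

TopConjunct-conj : ∀ {D} L → TopConjunct D (conj L) → Any (TopConjunct D) L
TopConjunct-conj (C ∷ [])     D∈C           = here D∈C
TopConjunct-conj (C ∷ C′ ∷ L) (inj₁ D∈C)    = here D∈C
TopConjunct-conj (C ∷ C′ ∷ L) (inj₂ D∈rest) = there (TopConjunct-conj (C′ ∷ L) D∈rest)

conj⊑atomic : ∀ {D} → Atomic D → ∀ L → conj L ⊑ D → Any (_⊑ D) L
conj⊑atomic (atomic-nm A) L L⊑A =
  Any.map (λ {C} → TopConjunct⇒⊑ C) (TopConjunct-conj L (⊑⇒canonical L⊑A))
conj⊑atomic (atomic-∃ r D) L L⊑∃rD with ⊑⇒canonical {conj L} {∃[ r ] D} L⊑∃rD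
... | e , ∃re∈L , De =
  Any.map (λ {C} ∃re∈C → ⊑-trans {C} {∃[ r ] e} {∃[ r ] D}
                            (TopConjunct⇒⊑ C ∃re∈C) (∃-mono {r} {e} {D} (canonical⇒⊑ D e De)))
          (TopConjunct-conj L ∃re∈L)

nm⊑nm⇒≡ : ∀ {A B} → nm A ⊑ nm B → A ≡ B
nm⊑nm⇒≡ {A} {B} A⊑B with ⊑⇒canonical {nm A} {nm B} A⊑B
... | refl = refl

con-injective : ∀ {A B} → con A ≡ con B → A ≡ B
con-injective refl = refl

∃⊑∃⇒≡ : ∀ {r s C D} → (∃[ r ] C) ⊑ (∃[ s ] D) → r ≡ s
∃⊑∃⇒≡ {r} {s} {C} {D} ∃rC⊑∃sD with ⊑⇒canonical {∃[ r ] C} {∃[ s ] D} ∃rC⊑∃sD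
... | _ , refl , _ = refl

∃-mono⁻ : ∀ {r C D} → (∃[ r ] C) ⊑ (∃[ r ] D) → C ⊑ D
∃-mono⁻ {r} {C} {D} ∃rC⊑∃rD with ⊑⇒canonical {∃[ r ] C} {∃[ r ] D} ∃rC⊑∃rD
... | _ , refl , DC = canonical⇒⊑ D C DC

nm⋢∃ : ∀ {A r C} → ¬ nm A ⊑ (∃[ r ] C)
nm⋢∃ {A} {r} {C} A⊑∃rC with ⊑⇒canonical {nm A} {∃[ r ] C} A⊑∃rC
... | _ , () , _

∃⋢nm : ∀ {A r C} → ¬ (∃[ r ] C) ⊑ nm A
∃⋢nm {A} {r} {C} ∃rC⊑A with ⊑⇒canonical {∃[ r ] C} {nm A} ∃rC⊑A
... | ()

depth : Concept → ℕ
depth ⊤c         = 0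
depth (nm _)     = 0
depth (C ⊓ D)    = depth C ⊔ depth D
depth (∃[ r ] C) = suc (depth C)

TopConjunct-depth : ∀ {D} P → TopConjunct D P → depth D ≤ depth P
TopConjunct-depth (nm A)     refl         = z≤n
TopConjunct-depth (P ⊓ P′)   (inj₁ D∈P)  = m≤n⇒m≤n⊔o (depth P′) (TopConjunct-depth P D∈P)
TopConjunct-depth (P ⊓ P′)   (inj₂ D∈P′) = m≤n⇒m≤o⊔n (depth P) (TopConjunct-depth P′ D∈P′)
TopConjunct-depth (∃[ r ] P) refl         = ≤-refl

canonical-depth : ∀ D P → ⟦ D ⟧ canonical P → depth D ≤ depth P
canonical-depth ⊤c         P _                 = z≤n
canonical-depth (nm A)     P _                 = z≤n
canonical-depth (D ⊓ D′)   P (DP , D′P)        =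
  ⊔-lub (canonical-depth D P DP) (canonical-depth D′ P D′P)
canonical-depth (∃[ r ] D) P (e , ∃re∈P , De) =
  ≤-trans (s≤s (canonical-depth D e De)) (TopConjunct-depth P ∃re∈P)

depth-antitone : ∀ {C D} → C ⊑ D → depth D ≤ depth C
depth-antitone {C} {D} C⊑D = canonical-depth D C (⊑⇒canonical {C} {D} C⊑D)

depth-exs : ∀ rs C → depth C ≤ depth (exs rs C)
depth-exs []       C = ≤-refl
depth-exs (r ∷ rs) C = ≤-trans (depth-exs rs C) (n≤1+n _)

_≻_ : Concept → Concept → Set₁
C ≻ D = ∃₂ λ r rs → C ⊑ exs (r ∷ rs) D

≻-irrefl : ∀ {C} → ¬ C ≻ C
≻-irrefl {C} (r , rs , C⊑C) =
  1+n≰n (≤-trans (s≤s (depth-exs rs C)) (depth-antitone {C} {exs (r ∷ rs) C} C⊑C))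

≻-trans : ∀ {C D E} → C ≻ D → D ≻ E → C ≻ E
≻-trans {C} {D} {E} (r , rs , C⊑D) (q , qs , D⊑E) =
  r , rs ++ q ∷ qs ,
  subst (C ⊑_) (exs-++ (r ∷ rs) (q ∷ qs) E)
        (⊑-trans {C} {exs (r ∷ rs) D} {exs (r ∷ rs) (exs (q ∷ qs) E)} C⊑D (exs-mono (r ∷ rs) D⊑E))

mutual
  exs-canonical? : ∀ D P → Dec (∃ λ rs → ⟦ exs rs D ⟧ canonical P)
  exs-canonical? D P =
    map′ (λ { (inj₁ DP) → [] , DP ; (inj₂ (r , rs , h)) → r ∷ rs , h })
         (λ { ([] , DP) → inj₁ DP ; (r ∷ rs , h) → inj₂ (r , rs , h) })
         (canonical? D P ⊎-dec exs⁺-canonical? D P)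

  exs⁺-canonical? : ∀ D P → Dec (∃₂ λ r rs → ⟦ exs (r ∷ rs) D ⟧ canonical P)
  exs⁺-canonical? D ⊤c     = no λ { (_ , _ , _ , () , _) }
  exs⁺-canonical? D (nm A) = no λ { (_ , _ , _ , () , _) }
  exs⁺-canonical? D (P ⊓ P′) =
    map′ (λ { (inj₁ (r , rs , e , e∈P , h)) → r , rs , e , inj₁ e∈P , h
            ; (inj₂ (r , rs , e , e∈P′ , h)) → r , rs , e , inj₂ e∈P′ , h })
         (λ { (r , rs , e , inj₁ e∈P , h) → inj₁ (r , rs , e , e∈P , h)
            ; (r , rs , e , inj₂ e∈P′ , h) → inj₂ (r , rs , e , e∈P′ , h) })
         (exs⁺-canonical? D P ⊎-dec exs⁺-canonical? D P′)
  exs⁺-canonical? D (∃[ s ] P) =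
    map′ (λ (rs , h) → s , rs , P , refl , h) (λ { (_ , rs , _ , refl , h) → rs , h })
         (exs-canonical? D P)

≻-dec : ∀ C D → Dec (C ≻ D)
≻-dec C D =
  map′ (λ (r , rs , h) → r , rs , canonical⇒⊑ (exs (r ∷ rs) D) C h)
       (λ (r , rs , C⊑D) → r , rs , ⊑⇒canonical {C} {exs (r ∷ rs) D} C⊑D)
       (exs⁺-canonical? D C)

τ-dec : ∀ σ x → Dec (τ σ x)
τ-dec σ [ C ⊑ D ]      = ⊑-dec (applyA σ C) (applyA σ D)
τ-dec σ [ X > Y ]      = ≻-dec (σ X) (σ Y)
τ-dec σ p[ C , X , D ] = ⊑-dec (σ X) (applyA σ D) ×-dec ¬? (⊑-dec (applyA σ C) (applyA σ D))

sat-⇒ : ∀ {val : PVar → Set₁} → (∀ x → Dec (val x)) →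
        ∀ {a cl} → (val a → SatClause val cl) → SatClause val (- a ∷ cl)
sat-⇒ val? {a} a⇒cl with val? a
... | yes a-holds = there (a⇒cl a-holds)
... | no ¬a       = here ¬a

Atnv-nonVar : ∀ {Γ E} → E ∈ Atnv Γ → isVarAtom E ≡ false
Atnv-nonVar {Γ} {E} E∈Atnv =
  nonVar E (proj₂ (∈-filter⁻ (λ a → T? (not (isVarAtom a))) {xs = At Γ} E∈Atnv))
  where
  nonVar : ∀ E → T (not (isVarAtom E)) → isVarAtom E ≡ false
  nonVar (at (con _)) _ = refl
  nonVar (ex _ _)     _ = refl

applyA-atomic : ∀ σ {E} → isVarAtom E ≡ false → Atomic (applyA σ E)
applyA-atomic σ {at (con A)} _ = atomic-nm (con A)
applyA-atomic σ {ex r A}     _ = atomic-∃ r (applyN σ A)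

conj⊑atom⇒sat : ∀ σ {E} → isVarAtom E ≡ false → ∀ L → conj (map (applyA σ) L) ⊑ applyA σ E →
                SatClause (τ σ) (map (λ C → + [ C ⊑ E ]) L)
conj⊑atom⇒sat σ E-nonVar L L⊑E =
  map⁺ (map⁻ (conj⊑atomic (applyA-atomic σ E-nonVar) (map (applyA σ) L) L⊑E))

-- If σ C ⋢ σ X = ⨅ σ(S_X), some D ∈ S_X ⊆ At_nv witnesses p_{C,X,D}.
sat-IV₁ : ∀ Γ σ C X (S : List Atom) → (∀ D → D ∈ S → D ∈ Atnv Γ) → σ X ≡ conj (map (applyA σ) S) →
          SatClause (τ σ) (+ [ C ⊑ v X ] ∷ map (λ D → + p[ C , X , D ]) (Atnv Γ))
sat-IV₁ Γ σ C X S S⊆Atnv σX≡⨅S with all? (λ D → ⊑-dec (applyA σ C) (applyA σ D)) S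
... | yes C⊑S = here (subst (applyA σ C ⊑_) (sym σX≡⨅S)
                              (⊑-conj {applyA σ C} (map (applyA σ) S) (All.map⁺ C⊑S)))
... | no C⋢S with find (All.¬All⇒Any¬ (λ D → ⊑-dec (applyA σ C) (applyA σ D)) S C⋢S)
...   | D , D∈S , C⋢D = there (map⁺ (lose (S⊆Atnv D D∈S) (σX⊑D , C⋢D)))
  where
  σX⊑D : σ X ⊑ applyA σ D
  σX⊑D = subst (_⊑ applyA σ D) (sym σX≡⨅S)
               (conj-⊑ (map (applyA σ) S) (∈-map⁺ (applyA σ) D∈S))

lemma6p6 : (Γ : Problem) (σ : Subst) → GroundLocalSolution Γ σ →
           (cl : Clause) → Cl Γ cl → SatClause (τ σ) cl
lemma6p6 Γ σ ((solves , dissolves) , _ , S , S⊆Atnv , _ , σ≡σS) = sat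
  where
  σA : Atom → Concept
  σA = applyA σ

  σN : Name → Concept
  σN = applyN σ

  assuming : ∀ {a cl} → (τ σ a → SatClause (τ σ) cl) → SatClause (τ σ) (- a ∷ cl)
  assuming = sat-⇒ (τ-dec σ)

  sat : (cl : Clause) → Cl Γ cl → SatClause (τ σ) cl
  sat _ (Ia s s∈Γ nonVar)       = conj⊑atom⇒sat σ nonVar (lhs s) (solves s s∈Γ)
  sat _ (Ib s X E s∈Γ refl E∈Atnv) = assuming λ X⊑E →
    conj⊑atom⇒sat σ (Atnv-nonVar {Γ} E∈Atnv) (lhs s)
                  (⊑-trans {conj (map σA (lhs s))} {σ X} {σA E} (solves s s∈Γ) X⊑E)
  sat _ (Ic X Y XY∈Γ)           = here (dissolves X Y XY∈Γ)
  sat _ (IIa A _)               = here (⊑-refl {nm (con A)})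
  sat _ (IIb A B _ _ A≢B)       = here (A≢B ∘ con-injective ∘ nm⊑nm⇒≡ {con A} {con B})
  sat _ (IIc r A s B _ _ r≢s)   = here (r≢s ∘ ∃⊑∃⇒≡ {r} {s} {σN A} {σN B})
  sat _ (IId₁ A r B _ _)        = here (nm⋢∃ {con A} {r} {σN B})
  sat _ (IId₂ A r B _ _)        = here (∃⋢nm {con A} {r} {σN B})
  sat _ (IIe₁ r A B _ _)        = assuming (here ∘ ∃-mono⁻ {r} {σN A} {σN B})
  sat _ (IIe₂ r A B _ _)        = assuming (here ∘ ∃-mono {r} {σN A} {σN B})
  sat _ (III C₁ C₂ C₃ _ _ _)    = assuming λ C₁⊑C₂ → assuming λ C₂⊑C₃ →
    here (⊑-trans {σA C₁} {σA C₂} {σA C₃} C₁⊑C₂ C₂⊑C₃)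
  sat _ (IV₁ C X _ X∈Nv)        = sat-IV₁ Γ σ C X (S X) (S⊆Atnv X X∈Nv) (σ≡σS X X∈Nv)
  sat _ (IV₂ C X D _ _ _)       = assuming (here ∘ proj₁)
  sat _ (IV₃ C X D _ _ _)       = assuming (here ∘ proj₂)
  sat _ (Va X _)                = here (≻-irrefl {σ X})
  sat _ (Vb X Y Z _ _ _)        = assuming λ X≻Y → assuming λ Y≻Z →
    here (≻-trans {σ X} {σ Y} {σ Z} X≻Y Y≻Z)
  sat _ (Vc X r Y _ _ _)        = assuming λ X⊑∃rY → here (r , [] , X⊑∃rY)
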